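{- Let $C$ be the canonical solution and $A$ an arbitrary solution. Then $C\models A$.
   Context: Fix a quantifier-free $F$ with free variable $x$ and a 1-grammar $U\circ V$, $U=\{u_1,\ldots,u_m\}$, $V=\{s_1,\ldots,s_k\}$, with schematic extended Herbrand sequent $H=F\{x\mapsto u_1\},\ldots,F\{x\mapsto u_m\},X(\alpha)\supset\bigwedge_{j=1}^kX(s_j)\rightarrow$ ($\{x\mapsto t\}$ denotes substitution). $\alpha$ is treated as a constant and $\models$ denotes propositional consequence. A quantifier-free formula $A$ is a solution if $F\{x\mapsto u_1\},\ldots,F\{x\mapsto u_m\},A\supset\bigwedge_{j=1}^kA\{\alpha\mapsto s_j\}\rightarrow$ is a tautology. The canonical solution is $C=\bigwedge_{i=1}^mF\{x\mapsto u_i\}$. -}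

module Defs where

open import Data.Nat using (ℕ; _≟_)
open import Data.Bool using (Bool; true; false; _∧_; _∨_; not; if_then_else_)
open import Data.List using (List; []; _∷_; map; foldr; _++_)
open import Data.Unit using (⊤)
open import Data.Product using (_×_)
open import Relation.Binary.PropositionalEquality using (_≡_)
open import Relation.Nullary.Decidable using (does)

data Term : Set where
  var : ℕ → Term
  fun : ℕ → List Term → Term

data Form : Set where
  ⊤ᶠ ⊥ᶠ : Form
  atom  : ℕ → List Term → Form
  ¬ᶠ_   : Form → Form
  _∧ᶠ_ _∨ᶠ_ _⊃ᶠ_ : Form → Form → Form

mutual
  substT : ℕ → Term → Term → Term
  substT y t (var z) = if does (z ≟ y) then t else var z
  substT y t (fun f ts) = fun f (substTs y t ts)

  substTs : ℕ → Term → List Term → List Term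
  substTs y t [] = []
  substTs y t (s ∷ ss) = substT y t s ∷ substTs y t ss

subst : ℕ → Term → Form → Form
subst y t ⊤ᶠ = ⊤ᶠ
subst y t ⊥ᶠ = ⊥ᶠ
subst y t (atom p ts) = atom p (substTs y t ts)
subst y t (¬ᶠ A) = ¬ᶠ subst y t A
subst y t (A ∧ᶠ B) = subst y t A ∧ᶠ subst y t B
subst y t (A ∨ᶠ B) = subst y t A ∨ᶠ subst y t B
subst y t (A ⊃ᶠ B) = subst y t A ⊃ᶠ subst y t B

mutual
  VarsInT : (ℕ → Set) → Term → Set
  VarsInT P (var z) = P z
  VarsInT P (fun f ts) = VarsInTs P ts

  VarsInTs : (ℕ → Set) → List Term → Set
  VarsInTs P [] = ⊤
  VarsInTs P (t ∷ ts) = VarsInT P t × VarsInTs P ts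

VarsIn : (ℕ → Set) → Form → Set
VarsIn P ⊤ᶠ = ⊤
VarsIn P ⊥ᶠ = ⊤
VarsIn P (atom p ts) = VarsInTs P ts
VarsIn P (¬ᶠ A) = VarsIn P A
VarsIn P (A ∧ᶠ B) = VarsIn P A × VarsIn P B
VarsIn P (A ∨ᶠ B) = VarsIn P A × VarsIn P B
VarsIn P (A ⊃ᶠ B) = VarsIn P A × VarsIn P B

-- Propositional semantics: atoms (with arbitrary, possibly open, terms;
-- variables such as α are treated as constants) are propositional variables.
Valuation : Set
Valuation = ℕ → List Term → Bool

⟦_⟧ : Form → Valuation → Bool
⟦ ⊤ᶠ ⟧ v = true
⟦ ⊥ᶠ ⟧ v = false
⟦ atom p ts ⟧ v = v p ts
⟦ ¬ᶠ A ⟧ v = not (⟦ A ⟧ v)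
⟦ A ∧ᶠ B ⟧ v = ⟦ A ⟧ v ∧ ⟦ B ⟧ v
⟦ A ∨ᶠ B ⟧ v = ⟦ A ⟧ v ∨ ⟦ B ⟧ v
⟦ A ⊃ᶠ B ⟧ v = not (⟦ A ⟧ v) ∨ ⟦ B ⟧ v

⋀ : List Form → Form
⋀ = foldr _∧ᶠ_ ⊤ᶠ

_⊨_ : Form → Form → Set
A ⊨ B = ∀ v → ⟦ A ⟧ v ≡ true → ⟦ B ⟧ v ≡ true

-- A sequent Γ → (empty succedent) is a tautology iff no valuation makes
-- all antecedent formulas true.
TautSeq : List Form → Set
TautSeq Γ = ∀ v → ⟦ ⋀ Γ ⟧ v ≡ false

instances : Form → ℕ → List Term → List Form
instances F x U = map (λ u → subst x u F) U

-- A is a solution of the schematic extended Herbrand sequent of F (free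
-- variable x) w.r.t. the 1-grammar U ∘ V with non-terminal α:
--   F{x↦u_1},…,F{x↦u_m}, A ⊃ ⋀_j A{α↦s_j} →  is a tautology.
IsSolution : Form → ℕ → ℕ → List Term → List Term → Form → Set
IsSolution F x α U V A =
  TautSeq (instances F x U ++ ((A ⊃ᶠ ⋀ (map (λ s → subst α s A) V)) ∷ []))

canonical : Form → ℕ → List Term → Form
canonical F x U = ⋀ (instances F x U)

module Submission where

-- To see C ⊨ A, take a valuation v with ⟦ C ⟧ v = true and
-- suppose ⟦ A ⟧ v = false. Then the implication A ⊃ … is true under v
-- (its antecedent fails), and the instances F{x↦u_i} are true since their
-- conjunction is C. So every antecedent formula of the sequent is true
-- under v, contradicting that the sequent is a tautology.
--
-- The theorem applies this with B the implication A ⊃ …,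
-- which holds whenever A fails.

open import Defs
open import Data.Nat using (ℕ)
open import Data.List using (List; []; _∷_; _++_; map)
open import Data.Bool using (true; false; _∧_)
open import Data.Bool.Properties using (∧-identityʳ)
open import Relation.Binary.PropositionalEquality
  using (_≡_; _≢_; refl; sym; cong)
open Relation.Binary.PropositionalEquality.≡-Reasoning

⋀-++ : ∀ (Γ Δ : List Form) v → ⟦ ⋀ (Γ ++ Δ) ⟧ v ≡ ⟦ ⋀ Γ ⟧ v ∧ ⟦ ⋀ Δ ⟧ v
⋀-++ [] Δ v = refl
⋀-++ (B ∷ Γ) Δ v with ⟦ B ⟧ v
... | true  = ⋀-++ Γ Δ v
... | false = refl

tautSeq-snoc : ∀ (Γ : List Form) (B : Form) v
  → TautSeq (Γ ++ B ∷ []) → ⟦ B ⟧ v ≡ true → ⟦ ⋀ Γ ⟧ v ≡ false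
tautSeq-snoc Γ B v taut B-true with ⟦ ⋀ Γ ⟧ v in Γ-val
... | false = refl
... | true  = begin
  true                          ≡⟨ sym B-true ⟩
  ⟦ B ⟧ v                       ≡⟨ sym (∧-identityʳ (⟦ B ⟧ v)) ⟩
  ⟦ B ⟧ v ∧ true                ≡⟨ sym (cong (_∧ ⟦ B ⟧ v ∧ true) Γ-val) ⟩
  ⟦ ⋀ Γ ⟧ v ∧ ⟦ ⋀ (B ∷ []) ⟧ v  ≡⟨ sym (⋀-++ Γ (B ∷ []) v) ⟩
  ⟦ ⋀ (Γ ++ B ∷ []) ⟧ v         ≡⟨ taut v ⟩
  false                         ∎

⊃-antecedent-false : ∀ (A B : Form) v → ⟦ A ⟧ v ≡ false → ⟦ A ⊃ᶠ B ⟧ v ≡ true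
⊃-antecedent-false A B v A-false rewrite A-false = refl

lemma6 : (F : Form) (x α : ℕ) (U V : List Term) (A : Form)
    → x ≢ α
    → VarsIn (λ z → z ≡ x) F
    → IsSolution F x α U V A
    → canonical F x U ⊨ A
lemma6 F x α U V A _ _ sol v C-true with ⟦ A ⟧ v in A-val
... | true  = refl
... | false = begin
  false                   ≡⟨ sym C-false ⟩
  ⟦ canonical F x U ⟧ v   ≡⟨ C-true ⟩
  true                    ∎
  where
  -- The implication A ⊃ … holds since A fails, so the instances cannot all hold.
  C-false : ⟦ canonical F x U ⟧ v ≡ false
  C-false = tautSeq-snoc (instances F x U) (A ⊃ᶠ ⋀ (map (λ s → subst α s A) V)) v sol
              (⊃-antecedent-false A (⋀ (map (λ s → subst α s A) V)) v A-val)
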